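{- Let $H_B$ be the ordered graph on vertex set $\{1,2,3,4\}$ with edge set $\{\{1,3\},\{2,4\}\}$ (an ordering of $K_2\cup K_2$). Then $r_<(H_B)=5$.
   Context: An ordered graph on $n$ vertices is a graph with vertex set $[n]=\{1,\dots,n\}$ equipped with the natural order. Given an ordered graph $H$ on $[n]$ and a red/blue coloring of the edges of the complete graph $K_N$ on vertex set $[N]$, a monochromatic ordered copy of $H$ is a strictly increasing map $\phi:[n]\to[N]$ such that all edges $\{\phi(i),\phi(j)\}$ with $\{i,j\}\in E(H)$ receive the same color. The ordered Ramsey number $r_<(H)$ is the least $N$ such that every red/blue coloring of the edges of the complete graph on $[N]$ contains a monochromatic ordered copy of $H$. -}

module Defs where

open import Data.Nat using (ℕ; _<_)
open import Data.Fin using (Fin; toℕ) renaming (_<_ to _<ᶠ_)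
open import Data.Fin.Patterns
open import Data.Bool using (Bool)
open import Data.List using (List; []; _∷_)
open import Data.List.Relation.Unary.All using (All)
open import Data.Product using (Σ; ∃; _×_; _,_)
open import Relation.Binary.PropositionalEquality using (_≡_)
open import Relation.Nullary using (¬_)

data Colour : Set where
  red blue : Colour

record OrderedGraph (n : ℕ) : Set where
  field
    edges     : List (Fin n × Fin n)
    edges-ord : All (λ e → Data.Product.proj₁ e <ᶠ Data.Product.proj₂ e) edges
open OrderedGraph public

-- A red/blue colouring of the edges of K_N on [N]: the colour of edge {x , y}
-- with x < y is c x y (values with x ≥ y are irrelevant).
Colouring : ℕ → Set
Colouring N = Fin N → Fin N → Colour

StrictlyIncreasing : ∀ {n N} → (Fin n → Fin N) → Set
StrictlyIncreasing φ = ∀ i j → i <ᶠ j → φ i <ᶠ φ j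

MonoCopy : ∀ {n N} → OrderedGraph n → Colouring N → Set
MonoCopy {n} {N} H c =
  Σ (Fin n → Fin N) λ φ → StrictlyIncreasing φ ×
    Σ Colour λ col → All (λ e → c (φ (Data.Product.proj₁ e)) (φ (Data.Product.proj₂ e)) ≡ col) (edges H)

Arrows : ∀ {n} → OrderedGraph n → ℕ → Set
Arrows H N = (c : Colouring N) → MonoCopy H c

OrderedRamseyNumberIs : ∀ {n} → OrderedGraph n → ℕ → Set
OrderedRamseyNumberIs H N = Arrows H N × (∀ M → M < N → ¬ Arrows H M)

-- H_B on {1,2,3,4} with edges {1,3},{2,4}; here vertices 0..3.
H-B : OrderedGraph 4
H-B = record
  { edges = (0F , 2F) ∷ (1F , 3F) ∷ []
  ; edges-ord = All._∷_ (Data.Nat.s≤s Data.Nat.z≤n) (All._∷_ (Data.Nat.s≤s (Data.Nat.s≤s Data.Nat.z≤n)) All.[])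
  }

-- On [5] the copies of H_B obtained by deleting one vertex pair up the edges
-- {1,3}, {2,4}, {3,5}, {1,4}, {2,5} cyclically, i.e. along a 5-cycle. An odd cycle has
-- no proper 2-colouring, so two consecutive edges of it share a colour and the
-- corresponding copy is monochromatic. Conversely, a copy of H_B needs four vertices
-- and on [4] it is the identity, so colouring each edge by whether it contains the
-- vertex 1 separates {1,3} from {2,4}.
module Submission where

open import Defs
open import Data.Nat using (ℕ; suc; _+_; _≤_; _<_; z≤n; s≤s)
open import Data.Nat.Properties using (≤-<-trans; <-≤-trans; +-monoʳ-<; <⇒≱; ≰⇒>; ≤-pred)
open import Data.Fin using (Fin; zero; suc; toℕ; punchIn)
open import Data.Fin.Properties using (toℕ<n; punchIn-cancel-≤)
open import Data.Fin.Patterns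
open import Data.List.Relation.Unary.All using (_∷_; [])
open import Data.Sum using (_⊎_; inj₁; inj₂)
open import Data.Product using (_,_)
open import Function using (_∘_)
open import Relation.Binary.PropositionalEquality using (_≡_; _≢_; refl; sym; trans)
open import Relation.Nullary using (¬_)

C₅-has-monochromatic-edge : (a b c d e : Colour) →
                            a ≡ b ⊎ b ≡ c ⊎ c ≡ d ⊎ d ≡ e ⊎ e ≡ a
C₅-has-monochromatic-edge red  red  _    _    _    = inj₁ refl
C₅-has-monochromatic-edge blue blue _    _    _    = inj₁ refl
C₅-has-monochromatic-edge red  blue blue _    _    = inj₂ (inj₁ refl)
C₅-has-monochromatic-edge blue red  red  _    _    = inj₂ (inj₁ refl)
C₅-has-monochromatic-edge red  blue red  red  _    = inj₂ (inj₂ (inj₁ refl))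
C₅-has-monochromatic-edge blue red  blue blue _    = inj₂ (inj₂ (inj₁ refl))
C₅-has-monochromatic-edge red  blue red  blue blue = inj₂ (inj₂ (inj₂ (inj₁ refl)))
C₅-has-monochromatic-edge blue red  blue red  red  = inj₂ (inj₂ (inj₂ (inj₁ refl)))
C₅-has-monochromatic-edge red  blue red  blue red  = inj₂ (inj₂ (inj₂ (inj₂ refl)))
C₅-has-monochromatic-edge blue red  blue red  blue = inj₂ (inj₂ (inj₂ (inj₂ refl)))

red≢blue : red ≢ blue
red≢blue ()

punchIn-strictlyIncreasing : ∀ {n} (i : Fin (suc n)) → StrictlyIncreasing (punchIn i)
punchIn-strictlyIncreasing i j k j<k = ≰⇒> (<⇒≱ j<k ∘ punchIn-cancel-≤ i k j)

strictlyIncreasing⇒n+φ₀<N : ∀ {n N} (φ : Fin (suc n) → Fin N) → StrictlyIncreasing φ →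
                            n + toℕ (φ zero) < N
strictlyIncreasing⇒n+φ₀<N {ℕ.zero} φ _   = toℕ<n (φ zero)
strictlyIncreasing⇒n+φ₀<N {suc n}  φ inc =
  ≤-<-trans (+-monoʳ-< n (inc zero 1F (s≤s z≤n)))
            (strictlyIncreasing⇒n+φ₀<N (φ ∘ suc) (λ i j → inc (suc i) (suc j) ∘ s≤s))

monoCopy-H-B : ∀ {N} (c : Colouring N) (φ : Fin 4 → Fin N) → StrictlyIncreasing φ →
               c (φ 0F) (φ 2F) ≡ c (φ 1F) (φ 3F) → MonoCopy H-B c
monoCopy-H-B c φ inc same = φ , inc , c (φ 0F) (φ 2F) , refl ∷ sym same ∷ []

monoCopy-avoiding : (c : Colouring 5) (k : Fin 5) →
                    c (punchIn k 0F) (punchIn k 2F) ≡ c (punchIn k 1F) (punchIn k 3F) →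
                    MonoCopy H-B c
monoCopy-avoiding c k = monoCopy-H-B c (punchIn k) (punchIn-strictlyIncreasing k)

arrows-H-B-5 : Arrows H-B 5
arrows-H-B-5 c with C₅-has-monochromatic-edge (c 0F 2F) (c 1F 3F) (c 2F 4F) (c 0F 3F) (c 1F 4F)
... | inj₁ same                      = monoCopy-avoiding c 4F same
... | inj₂ (inj₁ same)               = monoCopy-avoiding c 0F same
... | inj₂ (inj₂ (inj₁ same))        = monoCopy-avoiding c 1F (sym same)
... | inj₂ (inj₂ (inj₂ (inj₁ same))) = monoCopy-avoiding c 2F same
... | inj₂ (inj₂ (inj₂ (inj₂ same))) = monoCopy-avoiding c 3F (sym same)

starAtZero : ∀ {N} → Colouring N
starAtZero zero    _ = red
starAtZero (suc _) _ = blue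

¬monoCopy-starAtZero : ∀ {M} → M ≤ 4 → ¬ MonoCopy H-B (starAtZero {M})
¬monoCopy-starAtZero M≤4 (φ , inc , col , p ∷ q ∷ [])
  with φ 0F | φ 1F | inc 0F 1F (s≤s z≤n) | strictlyIncreasing⇒n+φ₀<N φ inc
... | zero  | zero  | () | _
... | zero  | suc _ | _  | _    = red≢blue (trans p (sym q))
... | suc _ | _     | _  | room with <-≤-trans room M≤4
...   | s≤s (s≤s (s≤s (s≤s ())))

proposition2p2 : OrderedRamseyNumberIs H-B 5
proposition2p2 = arrows-H-B-5 , λ M M<5 arrows → ¬monoCopy-starAtZero (≤-pred M<5) (arrows starAtZero)
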